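{- As formal power series in $q$ (equivalently for $|q|<1$), $$\sum_{n\ge 1}\mathit{pa}(n)q^n=\sum_{n\ge 1}\frac{q^n}{1-q^{n}}\prod_{k=1}^{n-1}\left(1+\frac{q^k}{1-q^{2k}}\right).$$
   Context: A partition of a positive integer $n$ is a weakly decreasing sequence of positive integers with sum $n$. An unlimited parity alternating partition is a partition whose different parts alternate in parity: if the distinct part sizes are $d_1>d_2>\cdots>d_r$, then $d_i$ and $d_{i+1}$ have different parities for every $i$ (parts may be repeated). $\mathit{pa}(n)$ is the number of such partitions of $n$. -}

module Defs where

open import Data.Nat using (ℕ; zero; suc; _+_; _*_; _∸_; _≤_; _≥_; _≟_)
open import Data.Nat.DivMod using (_%_)
open import Data.Nat.Divisibility using (_∣?_)
open import Data.List using (List; map; upTo; deduplicate)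
open import Data.Nat.ListAction using (sum)
open import Data.List.Relation.Unary.All using (All)
open import Data.List.Relation.Unary.Linked using (Linked)
open import Data.Product using (Σ; _×_)
open import Relation.Binary.PropositionalEquality using (_≡_)
open import Relation.Nullary.Decidable using (⌊_⌋)
open import Data.Bool using (if_then_else_)

DiffParity : ℕ → ℕ → Set
DiffParity a b = (a + b) % 2 ≡ 1

distinctParts : List ℕ → List ℕ
distinctParts = deduplicate _≟_

IsUPAPartitionOf : ℕ → List ℕ → Set
IsUPAPartitionOf n l =
  Linked _≥_ l
  × All (λ x → 1 ≤ x) l
  × sum l ≡ n
  × Linked DiffParity (distinctParts l)

-- the set of unlimited parity alternating partitions of n;
-- pa(n) is its cardinality
UPA : ℕ → Set
UPA n = Σ (List ℕ) (IsUPAPartitionOf n)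

-- Formal power series in q with coefficients in ℕ (coefficient function)

Series : Set
Series = ℕ → ℕ

sumBelow : ℕ → (ℕ → ℕ) → ℕ
sumBelow m f = sum (map f (upTo m))

one : Series
one zero    = 1
one (suc _) = 0

_⊕_ : Series → Series → Series
(f ⊕ g) m = f m + g m

_⊛_ : Series → Series → Series
(f ⊛ g) m = sumBelow (suc m) (λ i → f i * g (m ∸ i))

infixl 6 _⊕_
infixl 7 _⊛_

qpow : ℕ → Series
qpow k m = if ⌊ m ≟ k ⌋ then 1 else 0

-- 1/(1 - q^k) = Σ_{j ≥ 0} q^{kj}   (used for k ≥ 1)
geom : ℕ → Series
geom k m = if ⌊ k ∣? m ⌋ then 1 else 0

factor : ℕ → Series
factor k = one ⊕ qpow k ⊛ geom (2 * k)

prodFactors : ℕ → Series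
prodFactors zero          = one
prodFactors (suc zero)    = one
prodFactors (suc (suc j)) = prodFactors (suc j) ⊛ factor (suc j)

term : ℕ → Series
term n = qpow n ⊛ geom n ⊛ prodFactors n

-- Σ_{n ≥ 1} term n ; term n has q-adic order ≥ n, so the coefficient of q^m
-- only receives contributions from n = 1, ..., m.
rhs : Series
rhs m = sumBelow m (λ j → term (suc j) m)

module Submission where

-- A weighted class is a type of objects with a size; a series f
-- counts a class when, for every m, the objects of size m are in bijection
-- with Fin (f m).  The identity is proved bijectively, in three steps.
--
-- 1. Counting calculus (after a small toolkit of bijections): 1, q^k,
--    1/(1-q^k), sums, Cauchy products, and locally finite sums over ℕ count
--    the evident classes.  Hence rhs counts triples (n, t, choices), the
--    choice in the factor 1 + q^k/(1-q^{2k}) being 1 or q^k·q^{2ks}.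
-- 2. Codes: reading such a choice as a gap 0 or 2s+1 of weight k·gap, a
--    triple becomes a code (t, gaps) for the weakly increasing chain of n
--    parts starting at t+1 and rising by the gaps; its size is the chain's
--    sum.  For m ≥ 1, codes of size m are the positive gap chains of sum m.
-- 3. Parity: in a weakly decreasing list the distinct parts alternate in
--    parity iff consecutive entries are equal or differ by an odd number,
--    so reversal identifies UPA partitions with positive gap chains.

open import Defs
open import Data.Bool using (if_then_else_)
open import Data.Empty using (⊥-elim)
open import Data.Fin using (Fin; toℕ; fromℕ<) renaming (zero to fzero; suc to fsuc)
open import Data.Fin.Properties using (+↔⊎; *↔×; toℕ-fromℕ<; toℕ-injective; toℕ<n; fromℕ<-toℕ)
open import Data.List using (List; []; _∷_; applyUpTo; map; length; deduplicate; reverse; reverseAcc)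
open import Data.List.Properties using (filter-reject; filter-idem; filter-all; reverse-involutive)
open import Data.List.Relation.Unary.All as All using (All; []; _∷_)
open import Data.List.Relation.Unary.All.Properties using (deduplicate⁺)
open import Data.List.Relation.Unary.Linked as Linked using (Linked; []; [-]; _∷_)
open import Data.List.Relation.Binary.Permutation.Propositional using (↭-sym)
open import Data.List.Relation.Binary.Permutation.Propositional.Properties using (↭-reverse; All-resp-↭)
open import Data.Nat using (ℕ; zero; suc; _+_; _*_; _∸_; _≤_; _<_; _≥_; _≟_; z≤n; s≤s)
open import Data.Nat.DivMod using (_%_; _/_; m≡m%n+[m/n]*n; [m+kn]%n≡m%n)
open import Data.Nat.Divisibility using (divides; _∣?_)
open import Data.Nat.ListAction using (sum)
open import Data.Nat.ListAction.Properties using (sum-↭)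
open import Data.Nat.Properties
  using (≤-refl; ≤-trans; ≤-pred; ≤-<-trans; <⇒≤; <⇒≢; ≤∧≢⇒<; m≤m+n; m<m+n; ≤-irrelevant; ≡-irrelevant;
         +-comm; +-identityʳ; +-cancelˡ-≡; *-comm; *-zeroʳ; *-suc; *-cancelˡ-≡; suc-injective; m+[n∸m]≡n; m+n∸m≡n)
open import Data.Nat.Solver using (module +-*-Solver)
open import Data.Product using (Σ; _×_; _,_; proj₁; proj₂)
open import Data.Product.Function.Dependent.Propositional using (Σ-↔)
open import Data.Product.Function.NonDependent.Propositional using (_×-↔_)
open import Data.Sum using (_⊎_; inj₁; inj₂; [_,_])
open import Data.Sum.Function.Propositional using (_⊎-↔_)
open import Data.Unit using (⊤; tt)
open import Function.Base using (flip)
open import Function.Bundles using (_↔_; mk↔ₛ′; Inverse)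
open import Function.Properties.Inverse using (↔-refl; ↔-sym; ↔-trans)
open import Function.Related.TypeIsomorphisms using (Σ-assoc; Σ-distribʳ-⊎)
open import Relation.Binary.PropositionalEquality using (_≡_; refl; sym; trans; cong; cong₂; subst; module ≡-Reasoning)
open import Relation.Nullary using (Dec; yes; no; ¬_; ¬?; Irrelevant)
open import Relation.Nullary.Decidable using (⌊_⌋)
open +-*-Solver using (solve; _:=_; _:+_; _:*_; con)
open Inverse using (to)

infixr 5 _⟫_
_⟫_ : {A B C : Set} → A ↔ B → B ↔ C → A ↔ C
_⟫_ = ↔-trans

Σ-≡-irrelevant : {A : Set} {P : A → Set} → (∀ a → Irrelevant (P a)) →
                 {a b : A} → a ≡ b → (p : P a) (q : P b) →
                 _≡_ {A = Σ A P} (a , p) (b , q)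
Σ-≡-irrelevant irr {a} refl p q = cong (a ,_) (irr a p q)

×-irrelevant : {A B : Set} → Irrelevant A → Irrelevant B → Irrelevant (A × B)
×-irrelevant irrA irrB (a , b) (a′ , b′) = cong₂ _,_ (irrA a a′) (irrB b b′)

Σ-involution-↔ : {A : Set} {P Q : A → Set} (f : A → A) → (∀ a → f (f a) ≡ a) →
                 (∀ a → P a → Q (f a)) → (∀ a → Q a → P (f a)) →
                 (∀ a → Irrelevant (P a)) → (∀ a → Irrelevant (Q a)) → Σ A P ↔ Σ A Q
Σ-involution-↔ f involutive p⇒q q⇒p irrP irrQ = mk↔ₛ′
  (λ (a , p) → f a , p⇒q a p) (λ (b , q) → f b , q⇒p b q)
  (λ (b , q) → Σ-≡-irrelevant irrQ (involutive b) _ q)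
  (λ (a , p) → Σ-≡-irrelevant irrP (involutive a) _ p)

indicator-↔ : {P Q : Set} (d : Dec P) → (P → Q) → (Q → P) → Irrelevant Q →
              Fin (if ⌊ d ⌋ then 1 else 0) ↔ Q
indicator-↔ (yes p) p⇒q q⇒p irr =
  mk↔ₛ′ (λ _ → p⇒q p) (λ _ → fzero) (irr _) (λ { fzero → refl ; (fsuc ()) })
indicator-↔ (no ¬p) p⇒q q⇒p irr =
  mk↔ₛ′ (λ ()) (λ q → ⊥-elim (¬p (q⇒p q))) (λ q → ⊥-elim (¬p (q⇒p q))) (λ ())

Fin-sumBelow-↔ : ∀ n (g : ℕ → ℕ) → Fin (sumBelow n g) ↔ Σ (Fin n) (λ i → Fin (g (toℕ i)))
Fin-sumBelow-↔ n g = Fin-sum-↔ n (λ i → i)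
  where
  Fin-sum-↔ : ∀ n (f : ℕ → ℕ) →
              Fin (sum (map g (applyUpTo f n))) ↔ Σ (Fin n) (λ i → Fin (g (f (toℕ i))))
  Fin-sum-↔ zero    f = mk↔ₛ′ (λ ()) (λ ()) (λ ()) (λ ())
  Fin-sum-↔ (suc n) f = +↔⊎ ⟫ (↔-refl ⊎-↔ Fin-sum-↔ n (λ i → f (suc i))) ⟫ mk↔ₛ′
    (λ { (inj₁ x) → fzero , x ; (inj₂ (i , x)) → fsuc i , x })
    (λ { (fzero , x) → inj₁ x ; (fsuc i , x) → inj₂ (i , x) })
    (λ { (fzero , x) → refl ; (fsuc i , x) → refl })
    (λ { (inj₁ x) → refl ; (inj₂ (i , x)) → refl })

Σ-Fin-↔ : ∀ m (B : ℕ → Set) → (∀ j → B j → j < m) → Σ (Fin m) (λ i → B (toℕ i)) ↔ Σ ℕ B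
Σ-Fin-↔ m B bounded = mk↔ₛ′ (λ (i , b) → toℕ i , b)
  (λ (j , b) → fromℕ< (bounded j b) , subst B (sym (toℕ-fromℕ< (bounded j b))) b)
  (λ (j , b) → forget (toℕ-fromℕ< (bounded j b)) b)
  (λ (i , b) → remember (fromℕ<-toℕ i _) (toℕ-fromℕ< (bounded (toℕ i) b)) b)
  where
  forget : ∀ {x y} (e : x ≡ y) (b : B y) → _≡_ {A = Σ ℕ B} (x , subst B (sym e) b) (y , b)
  forget refl b = refl
  remember : ∀ {k i : Fin m} → k ≡ i → (e : toℕ k ≡ toℕ i) (b : B (toℕ i)) →
             _≡_ {A = Σ (Fin m) (λ i → B (toℕ i))} (k , subst B (sym e) b) (i , b)
  remember refl e b rewrite ≡-irrelevant e refl = refl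

record Class : Set₁ where
  constructor class
  field
    Obj  : Set
    size : Obj → ℕ
open Class

Fiber : Class → ℕ → Set
Fiber C m = Σ (Obj C) (λ x → size C x ≡ m)

Counts : Class → Series → Set
Counts C f = ∀ m → Fin (f m) ↔ Fiber C m

counts-transport : ∀ {C D f} (φ : Obj C ↔ Obj D) → (∀ x → size D (to φ x) ≡ size C x) →
                   Counts C f → Counts D f
counts-transport {C} {D} φ preserves counts m =
  counts m ⟫ Σ-↔ φ (λ {x} → resize (preserves x))
  where
  resize : ∀ {a b} → b ≡ a → (a ≡ m) ↔ (b ≡ m)
  resize b≡a = mk↔ₛ′ (trans b≡a) (trans (sym b≡a)) (λ _ → ≡-irrelevant _ _) (λ _ → ≡-irrelevant _ _)

point : ℕ → Class
point k = class ⊤ (λ _ → k)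

counts-qpow : ∀ k → Counts (point k) (qpow k)
counts-qpow k m = indicator-↔ (m ≟ k) (λ m≡k → tt , sym m≡k) (λ (_ , k≡m) → sym k≡m)
  (λ { (tt , p) (tt , q) → cong (tt ,_) (≡-irrelevant p q) })

counts-one : Counts (point 0) one
counts-one zero    = counts-qpow 0 zero
counts-one (suc m) = counts-qpow 0 (suc m)

multiples : ℕ → Class
multiples k = class ℕ (k *_)

counts-geom : ∀ k → Counts (multiples (suc k)) (geom (suc k))
counts-geom k m = indicator-↔ (suc k ∣? m)
  (λ (divides t m≡t*k) → t , trans (*-comm (suc k) t) (sym m≡t*k))
  (λ (t , k*t≡m) → divides t (trans (sym k*t≡m) (*-comm (suc k) t)))
  (λ (t , p) (t′ , q) → Σ-≡-irrelevant (λ _ → ≡-irrelevant) (*-cancelˡ-≡ t t′ (suc k) (trans p (sym q))) p q)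

_⊕c_ : Class → Class → Class
C ⊕c D = class (Obj C ⊎ Obj D) [ size C , size D ]

counts-⊕ : ∀ {C D f g} → Counts C f → Counts D g → Counts (C ⊕c D) (f ⊕ g)
counts-⊕ countsC countsD m = +↔⊎ ⟫ (countsC m ⊎-↔ countsD m) ⟫ ↔-sym Σ-distribʳ-⊎

_⊛c_ : Class → Class → Class
C ⊛c D = class (Obj C × Obj D) (λ (x , y) → size C x + size D y)

split-↔ : ∀ C D m → Σ (Fin (suc m)) (λ i → Fiber C (toℕ i) × Fiber D (m ∸ toℕ i)) ↔ Fiber (C ⊛c D) m
split-↔ C D m = mk↔ₛ′ join split (λ (xy , _) → cong (xy ,_) (≡-irrelevant _ _)) split-join
  where
  join : Σ (Fin (suc m)) (λ i → Fiber C (toℕ i) × Fiber D (m ∸ toℕ i)) → Fiber (C ⊛c D) m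
  join (i , (x , p) , (y , q)) = (x , y) , trans (cong₂ _+_ p q) (m+[n∸m]≡n (≤-pred (toℕ<n i)))
  left<m : ∀ x y → size C x + size D y ≡ m → size C x < suc m
  left<m x y e = s≤s (subst (size C x ≤_) e (m≤m+n (size C x) (size D y)))
  split : Fiber (C ⊛c D) m → Σ (Fin (suc m)) (λ i → Fiber C (toℕ i) × Fiber D (m ∸ toℕ i))
  split ((x , y) , e) = fromℕ< lt , (x , sym (toℕ-fromℕ< lt)) , (y , rest)
    where
    lt : size C x < suc m
    lt = left<m x y e
    rest : size D y ≡ m ∸ toℕ (fromℕ< lt)
    rest = begin
      size D y                       ≡⟨ m+n∸m≡n (size C x) (size D y) ⟨
      size C x + size D y ∸ size C x ≡⟨ cong (_∸ size C x) e ⟩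
      m ∸ size C x                   ≡⟨ cong (m ∸_) (toℕ-fromℕ< lt) ⟨
      m ∸ toℕ (fromℕ< lt)            ∎
      where open ≡-Reasoning
  same-split : ∀ {i j} → i ≡ j → ∀ {x y} (p : size C x ≡ toℕ i) p′ (q : size D y ≡ m ∸ toℕ i) q′ →
               _≡_ {A = Σ (Fin (suc m)) (λ i → Fiber C (toℕ i) × Fiber D (m ∸ toℕ i))}
                   (i , (x , p) , (y , q)) (j , (x , p′) , (y , q′))
  same-split refl p p′ q q′ = cong₂ (λ p q → _ , (_ , p) , (_ , q)) (≡-irrelevant p p′) (≡-irrelevant q q′)
  split-join : ∀ s → split (join s) ≡ s
  split-join (i , (x , p) , (y , q)) = same-split (toℕ-injective (trans (toℕ-fromℕ< _) p)) _ _ _ _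

counts-⊛ : ∀ {C D f g} → Counts C f → Counts D g → Counts (C ⊛c D) (f ⊛ g)
counts-⊛ {C} {D} {f} {g} countsC countsD m =
  Fin-sumBelow-↔ (suc m) (λ i → f i * g (m ∸ i)) ⟫
  Σ-↔ ↔-refl (λ {i} → *↔× ⟫ (countsC (toℕ i) ×-↔ countsD (m ∸ toℕ i))) ⟫
  split-↔ C D m

Σc : (ℕ → Class) → Class
Σc C = class (Σ ℕ (λ j → Obj (C j))) (λ (j , x) → size (C j) x)

counts-Σ : (C : ℕ → Class) (f : ℕ → Series) → (∀ j → Counts (C j) (f j)) →
           (∀ j x → j < size (C j) x) → Counts (Σc C) (λ m → sumBelow m (λ j → f j m))
counts-Σ C f counts large m =
  Fin-sumBelow-↔ m (λ j → f j m) ⟫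
  Σ-↔ ↔-refl (λ {i} → counts (toℕ i) m) ⟫
  Σ-Fin-↔ m (λ j → Fiber (C j) m) (λ j (x , size≡m) → subst (j <_) size≡m (large j x)) ⟫
  ↔-sym Σ-assoc

factorClass : ℕ → Class
factorClass k = point 0 ⊕c (point k ⊛c multiples (2 * k))

counts-factor : ∀ j → Counts (factorClass (suc j)) (factor (suc j))
counts-factor j = counts-⊕ counts-one (counts-⊛ (counts-qpow (suc j)) (counts-geom (j + suc (j + 0))))

productClass : ℕ → Class
productClass zero          = point 0
productClass (suc zero)    = point 0
productClass (suc (suc j)) = productClass (suc j) ⊛c factorClass (suc j)

counts-product : ∀ n → Counts (productClass n) (prodFactors n)
counts-product zero          = counts-one
counts-product (suc zero)    = counts-one
counts-product (suc (suc j)) = counts-⊛ (counts-product (suc j)) (counts-factor j)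

termClass : ℕ → Class
termClass n = (point n ⊛c multiples n) ⊛c productClass n

counts-term : ∀ j → Counts (termClass (suc j)) (term (suc j))
counts-term j = counts-⊛ (counts-⊛ (counts-qpow (suc j)) (counts-geom j)) (counts-product (suc j))

-- All objects of the n-th term have size ≥ n, because of the factor q^n.
termClass-large : ∀ j x → j < size (termClass (suc j)) x
termClass-large j ((tt , t) , _) = ≤-trans (m≤m+n (suc j) (suc j * t)) (m≤m+n _ _)

rhsClass : Class
rhsClass = Σc (λ j → termClass (suc j))

counts-rhs : Counts rhsClass rhs
counts-rhs = counts-Σ (λ j → termClass (suc j)) (λ j → term (suc j)) counts-term termClass-large

-- A choice in a factor 1 + q^k/(1-q^{2k}), read as a gap: 0 for the term 1,
-- and the odd number 2s+1 for q^k·q^{2ks}.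
Gap : Set
Gap = ⊤ ⊎ (⊤ × ℕ)

gap : Gap → ℕ
gap (inj₁ _)       = 0
gap (inj₂ (_ , s)) = suc (2 * s)

factor-size : ∀ j δ → size (factorClass (suc j)) δ ≡ suc j * gap δ
factor-size j (inj₁ tt)      = sym (*-zeroʳ j)
factor-size j (inj₂ (tt , s)) =
  solve 2 (λ j s → (con 1 :+ j) :+ (con 2 :* (con 1 :+ j)) :* s := (con 1 :+ j) :* (con 1 :+ con 2 :* s)) refl j s

chain      : ℕ → List Gap → List ℕ
chainAbove : ℕ → List Gap → List ℕ
chain c δs = c ∷ chainAbove c δs
chainAbove c []       = []
chainAbove c (δ ∷ δs) = chain (c + gap δ) δs

-- Each gap is counted once for every later entry of the chain.
gapWeight : List Gap → ℕ
gapWeight []       = 0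
gapWeight (δ ∷ δs) = suc (length δs) * gap δ + gapWeight δs

sum-chain : ∀ c δs → sum (chain c δs) ≡ suc (length δs) * c + gapWeight δs
sum-chain c []       = solve 1 (λ c → c :+ con 0 := con 1 :* c :+ con 0) refl c
sum-chain c (δ ∷ δs) = trans (cong (c +_) (sum-chain (c + gap δ) δs))
  (solve 4 (λ c v n W → c :+ ((con 1 :+ n) :* (c :+ v) :+ W) := (con 2 :+ n) :* c :+ ((con 1 :+ n) :* v :+ W))
         refl c (gap δ) (length δs) (gapWeight δs))

codeClass : Class
codeClass = class (ℕ × List Gap) (λ (t , δs) → sum (chain (suc t) δs))

-- The choices in ∏_{k=1}^{j}, listed from the factor k = j down to k = 1,
-- form a list of j gaps; its first gap precedes j entries of the chain.
gapsOf : ∀ j → Obj (productClass (suc j)) → List Gap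
gapsOf zero    tt      = []
gapsOf (suc j) (p , δ) = δ ∷ gapsOf j p

choicesOf : List Gap → Σ ℕ (λ j → Obj (productClass (suc j)))
choicesOf []       = 0 , tt
choicesOf (δ ∷ δs) = suc (proj₁ (choicesOf δs)) , (proj₂ (choicesOf δs) , δ)

gapsOf-choicesOf : ∀ δs → gapsOf (proj₁ (choicesOf δs)) (proj₂ (choicesOf δs)) ≡ δs
gapsOf-choicesOf []       = refl
gapsOf-choicesOf (δ ∷ δs) = cong (δ ∷_) (gapsOf-choicesOf δs)

choicesOf-gapsOf : ∀ j p → choicesOf (gapsOf j p) ≡ (j , p)
choicesOf-gapsOf zero    tt      = refl
choicesOf-gapsOf (suc j) (p , δ) = cong (λ (j , p) → suc j , (p , δ)) (choicesOf-gapsOf j p)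

length-gapsOf : ∀ j p → length (gapsOf j p) ≡ j
length-gapsOf zero    tt      = refl
length-gapsOf (suc j) (p , δ) = cong suc (length-gapsOf j p)

gapWeight-gapsOf : ∀ j p → gapWeight (gapsOf j p) ≡ size (productClass (suc j)) p
gapWeight-gapsOf zero    tt      = refl
gapWeight-gapsOf (suc j) (p , δ) = begin
  suc (length (gapsOf j p)) * gap δ + gapWeight (gapsOf j p)
    ≡⟨ cong₂ (λ n w → suc n * gap δ + w) (length-gapsOf j p) (gapWeight-gapsOf j p) ⟩
  suc j * gap δ + size (productClass (suc j)) p
    ≡⟨ cong (_+ size (productClass (suc j)) p) (factor-size j δ) ⟨
  size (factorClass (suc j)) δ + size (productClass (suc j)) p
    ≡⟨ +-comm (size (factorClass (suc j)) δ) _ ⟩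
  size (productClass (suc j)) p + size (factorClass (suc j)) δ ∎
  where open ≡-Reasoning

rhs↔codes : Obj rhsClass ↔ Obj codeClass
rhs↔codes = mk↔ₛ′
  (λ (j , ((tt , t) , p)) → t , gapsOf j p)
  (λ (t , δs) → proj₁ (choicesOf δs) , ((tt , t) , proj₂ (choicesOf δs)))
  (λ (t , δs) → cong (t ,_) (gapsOf-choicesOf δs))
  (λ (j , ((tt , t) , p)) → cong (λ (j , p) → j , ((tt , t) , p)) (choicesOf-gapsOf j p))

rhs↔codes-size : ∀ x → size codeClass (to rhs↔codes x) ≡ size rhsClass x
rhs↔codes-size (j , ((tt , t) , p)) = begin
  sum (chain (suc t) (gapsOf j p))
    ≡⟨ sum-chain (suc t) (gapsOf j p) ⟩
  suc (length (gapsOf j p)) * suc t + gapWeight (gapsOf j p)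
    ≡⟨ cong₂ (λ n w → suc n * suc t + w) (length-gapsOf j p) (gapWeight-gapsOf j p) ⟩
  suc j * suc t + size (productClass (suc j)) p
    ≡⟨ cong (_+ size (productClass (suc j)) p) (*-suc (suc j) t) ⟩
  suc j + suc j * t + size (productClass (suc j)) p ∎
  where open ≡-Reasoning

counts-codes : Counts codeClass rhs
counts-codes = counts-transport rhs↔codes rhs↔codes-size counts-rhs

GapStep : ℕ → ℕ → Set
GapStep a b = Σ Gap (λ δ → b ≡ a + gap δ)

gap-injective : ∀ δ δ′ → gap δ ≡ gap δ′ → δ ≡ δ′
gap-injective (inj₁ tt)       (inj₁ tt)        _ = refl
gap-injective (inj₂ (tt , s)) (inj₂ (tt , s′)) e =
  cong (λ s → inj₂ (tt , s)) (*-cancelˡ-≡ s s′ 2 (suc-injective e))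

GapStep-irrelevant : ∀ {a b} → Irrelevant (GapStep a b)
GapStep-irrelevant {a} (δ , e) (δ′ , e′) =
  Σ-≡-irrelevant (λ _ → ≡-irrelevant) (gap-injective δ δ′ (+-cancelˡ-≡ a _ _ (trans (sym e) e′))) e e′

GapChain : ℕ → List ℕ → Set
GapChain m ν = Linked GapStep ν × All (1 ≤_) ν × sum ν ≡ m

GapChain-irrelevant : ∀ m ν → Irrelevant (GapChain m ν)
GapChain-irrelevant m ν = ×-irrelevant (Linked.irrelevant GapStep-irrelevant)
  (×-irrelevant (All.irrelevant ≤-irrelevant) ≡-irrelevant)

chain-linked : ∀ c δs → Linked GapStep (chain c δs)
chain-linked c []       = [-]
chain-linked c (δ ∷ δs) = (δ , refl) ∷ chain-linked (c + gap δ) δs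

chain-above : ∀ c δs → All (c ≤_) (chain c δs)
chain-above c []       = ≤-refl ∷ []
chain-above c (δ ∷ δs) = ≤-refl ∷ All.map (≤-trans (m≤m+n c (gap δ))) (chain-above (c + gap δ) δs)

gapsBetween : ∀ c ν → Linked GapStep (c ∷ ν) → List Gap
gapsBetween c []      _             = []
gapsBetween c (c′ ∷ ν) ((δ , _) ∷ L) = δ ∷ gapsBetween c′ ν L

chain-gapsBetween : ∀ c ν (L : Linked GapStep (c ∷ ν)) → chain c (gapsBetween c ν L) ≡ c ∷ ν
chain-gapsBetween c []       _             = refl
chain-gapsBetween c (c′ ∷ ν) ((δ , e) ∷ L) =
  cong (c ∷_) (trans (cong (λ c′ → chain c′ (gapsBetween _ ν L)) (sym e)) (chain-gapsBetween c′ ν L))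

gapsBetween-chain : ∀ c δs → gapsBetween c (chainAbove c δs) (chain-linked c δs) ≡ δs
gapsBetween-chain c []       = refl
gapsBetween-chain c (δ ∷ δs) = cong (δ ∷_) (gapsBetween-chain (c + gap δ) δs)

codes↔chains : ∀ m → 1 ≤ m → Fiber codeClass m ↔ Σ (List ℕ) (GapChain m)
codes↔chains m m≥1 = mk↔ₛ′ decode encode decode-encode encode-decode
  where
  decode : Fiber codeClass m → Σ (List ℕ) (GapChain m)
  decode ((t , δs) , sum≡m) =
    chain (suc t) δs , chain-linked (suc t) δs , All.map (≤-trans (s≤s z≤n)) (chain-above (suc t) δs) , sum≡m
  encode : Σ (List ℕ) (GapChain m) → Fiber codeClass m
  encode ([]          , _ , _        , sum≡m) with () ← subst (1 ≤_) (sym sum≡m) m≥1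
  encode (zero  ∷ ν   , _ , (() ∷ _) , _)
  encode (suc t ∷ ν   , L , _        , sum≡m) =
    (t , gapsBetween (suc t) ν L) , trans (cong sum (chain-gapsBetween (suc t) ν L)) sum≡m
  decode-encode : ∀ c → decode (encode c) ≡ c
  decode-encode ([]          , _ , _        , sum≡m) with () ← subst (1 ≤_) (sym sum≡m) m≥1
  decode-encode (zero  ∷ ν   , _ , (() ∷ _) , _)
  decode-encode (suc t ∷ ν   , L , _        , _) =
    Σ-≡-irrelevant (GapChain-irrelevant m) (chain-gapsBetween (suc t) ν L) _ _
  encode-decode : ∀ x → encode (decode x) ≡ x
  encode-decode ((t , δs) , _) =
    Σ-≡-irrelevant (λ _ → ≡-irrelevant) (cong (t ,_) (gapsBetween-chain (suc t) δs)) _ _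

parity-shift : ∀ y k → (y + k + y) % 2 ≡ k % 2
parity-shift y k =
  trans (cong (_% 2) (solve 2 (λ y k → y :+ k :+ y := k :+ y :* con 2) refl y k)) ([m+kn]%n≡m%n k y 2)

odd-gap⇒DiffParity : ∀ y s → DiffParity (y + suc (2 * s)) y
odd-gap⇒DiffParity y s = begin
  (y + suc (2 * s) + y) % 2 ≡⟨ parity-shift y (suc (2 * s)) ⟩
  suc (2 * s) % 2           ≡⟨ cong (_% 2) (cong suc (*-comm 2 s)) ⟩
  (1 + s * 2) % 2           ≡⟨ [m+kn]%n≡m%n 1 s 2 ⟩
  1                         ∎
  where open ≡-Reasoning

DiffParity⇒odd-gap : ∀ y k → DiffParity (y + k) y → Σ ℕ (λ s → k ≡ suc (2 * s))
DiffParity⇒odd-gap y k diff = k / 2 , trans (m≡m%n+[m/n]*n k 2) (cong₂ _+_ k-odd (*-comm (k / 2) 2))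
  where
  k-odd : k % 2 ≡ 1
  k-odd = trans (sym (parity-shift y k)) diff

distinctParts-repeat : ∀ x xs → distinctParts (x ∷ x ∷ xs) ≡ distinctParts (x ∷ xs)
distinctParts-repeat x xs =
  cong (x ∷_) (trans (filter-reject x≢? {x} (λ x≢x → x≢x refl)) (filter-idem x≢? (deduplicate _≟_ xs)))
  where
  x≢? : (z : ℕ) → Dec (¬ x ≡ z)
  x≢? z = ¬? (x ≟ z)

distinctParts-new : ∀ x xs → All (_< x) xs → distinctParts (x ∷ xs) ≡ x ∷ distinctParts xs
distinctParts-new x xs below =
  cong (x ∷_) (filter-all x≢? (deduplicate⁺ _≟_ (All.map (λ z<x x≡z → <⇒≢ z<x (sym x≡z)) below)))
  where
  x≢? : (z : ℕ) → Dec (¬ x ≡ z)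
  x≢? z = ¬? (x ≟ z)

below-head : ∀ {x y ys} → y < x → Linked _≥_ (y ∷ ys) → All (_< x) (y ∷ ys)
below-head {ys = []}     y<x [-]           = y<x ∷ []
below-head {ys = z ∷ zs} y<x (z≤y ∷ desc) = y<x ∷ below-head (≤-<-trans z≤y y<x) desc

alternating⇒gaps : ∀ l → Linked _≥_ l → Linked DiffParity (distinctParts l) → Linked (flip GapStep) l
alternating⇒gaps []           _            _   = []
alternating⇒gaps (x ∷ [])     _            _   = [-]
alternating⇒gaps (x ∷ y ∷ ys) (y≤x ∷ desc) alt with x ≟ y
... | yes refl = (inj₁ tt , sym (+-identityʳ x)) ∷
                 alternating⇒gaps (x ∷ ys) desc (subst (Linked DiffParity) (distinctParts-repeat x ys) alt)
... | no x≢y   = (inj₂ (tt , proj₁ odd) , trans x≡y+k (cong (y +_) (proj₂ odd))) ∷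
                 alternating⇒gaps (y ∷ ys) desc (Linked.tail alt′)
  where
  alt′ : Linked DiffParity (x ∷ distinctParts (y ∷ ys))
  alt′ = subst (Linked DiffParity) (distinctParts-new x (y ∷ ys) (below-head (≤∧≢⇒< y≤x (λ e → x≢y (sym e))) desc)) alt
  x≡y+k : x ≡ y + (x ∸ y)
  x≡y+k = sym (m+[n∸m]≡n y≤x)
  odd : Σ ℕ (λ s → x ∸ y ≡ suc (2 * s))
  odd = DiffParity⇒odd-gap y (x ∸ y) (subst (λ z → DiffParity z y) x≡y+k (Linked.head alt′))

gaps⇒alternating : ∀ l → Linked (flip GapStep) l → Linked _≥_ l × Linked DiffParity (distinctParts l)
gaps⇒alternating []           _ = [] , []
gaps⇒alternating (x ∷ [])     _ = [-] , [-]
gaps⇒alternating (x ∷ y ∷ ys) ((inj₁ tt , x≡y+0) ∷ steps) =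
  subst (y ≤_) (sym x≡y) ≤-refl ∷ desc ,
  subst (λ z → Linked DiffParity (distinctParts (z ∷ y ∷ ys))) (sym x≡y)
        (subst (Linked DiffParity) (sym (distinctParts-repeat y ys)) alt)
  where
  x≡y : x ≡ y
  x≡y = trans x≡y+0 (+-identityʳ y)
  rest : Linked _≥_ (y ∷ ys) × Linked DiffParity (distinctParts (y ∷ ys))
  rest = gaps⇒alternating (y ∷ ys) steps
  desc : Linked _≥_ (y ∷ ys)
  desc = proj₁ rest
  alt : Linked DiffParity (distinctParts (y ∷ ys))
  alt = proj₂ rest
gaps⇒alternating (x ∷ y ∷ ys) ((inj₂ (tt , s) , x≡y+odd) ∷ steps) =
  <⇒≤ y<x ∷ desc ,
  subst (Linked DiffParity) (sym (distinctParts-new x (y ∷ ys) (below-head y<x desc)))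
        (subst (λ z → DiffParity z y) (sym x≡y+odd) (odd-gap⇒DiffParity y s) ∷ alt)
  where
  y<x : y < x
  y<x = subst (y <_) (sym x≡y+odd) (m<m+n y (s≤s z≤n))
  rest : Linked _≥_ (y ∷ ys) × Linked DiffParity (distinctParts (y ∷ ys))
  rest = gaps⇒alternating (y ∷ ys) steps
  desc : Linked _≥_ (y ∷ ys)
  desc = proj₁ rest
  alt : Linked DiffParity (distinctParts (y ∷ ys))
  alt = proj₂ rest

reverse-linked : {A : Set} {R : A → A → Set} {l : List A} → Linked R l → Linked (flip R) (reverse l)
reverse-linked {l = []}     _      = []
reverse-linked {l = x ∷ xs} linked = onto x xs [] linked [-]
  where
  onto : ∀ {A R} (x : A) xs acc → Linked R (x ∷ xs) → Linked (flip R) (x ∷ acc) →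
         Linked (flip R) (reverseAcc (x ∷ acc) xs)
  onto x []       acc _            done = done
  onto x (y ∷ ys) acc (r ∷ linked) done = onto y ys (x ∷ acc) linked (r ∷ done)

IsUPAPartitionOf-irrelevant : ∀ m l → Irrelevant (IsUPAPartitionOf m l)
IsUPAPartitionOf-irrelevant m l = ×-irrelevant (Linked.irrelevant ≤-irrelevant)
  (×-irrelevant (All.irrelevant ≤-irrelevant) (×-irrelevant ≡-irrelevant (Linked.irrelevant ≡-irrelevant)))

upa↔chains : ∀ m → UPA m ↔ Σ (List ℕ) (GapChain m)
upa↔chains m = Σ-involution-↔ reverse reverse-involutive upa⇒chain chain⇒upa
  (IsUPAPartitionOf-irrelevant m) (GapChain-irrelevant m)
  where
  upa⇒chain : ∀ l → IsUPAPartitionOf m l → GapChain m (reverse l)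
  upa⇒chain l (desc , pos , sum≡m , alt) =
    reverse-linked (alternating⇒gaps l desc alt) ,
    All-resp-↭ (↭-sym (↭-reverse l)) pos ,
    trans (sum-↭ (↭-reverse l)) sum≡m
  chain⇒upa : ∀ ν → GapChain m ν → IsUPAPartitionOf m (reverse ν)
  chain⇒upa ν (steps , pos , sum≡m) =
    proj₁ desc×alt , All-resp-↭ (↭-sym (↭-reverse ν)) pos , trans (sum-↭ (↭-reverse ν)) sum≡m , proj₂ desc×alt
    where
    desc×alt : Linked _≥_ (reverse ν) × Linked DiffParity (distinctParts (reverse ν))
    desc×alt = gaps⇒alternating (reverse ν) (reverse-linked steps)

theorem3p2 : (rhs 0 ≡ 0)
    × ((n : ℕ) → 1 ≤ n → UPA n ↔ Fin (rhs n))
theorem3p2 = refl , λ n n≥1 →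
  upa↔chains n ⟫ ↔-sym (codes↔chains n n≥1) ⟫ ↔-sym (counts-codes n)
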